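{- Let $G$ be a finite bipartite graph with no isolated vertices in which every vertex has even degree, and let $D(G)$ denote the set of vertex degrees of $G$ and $\Delta(G)$ its maximum degree. Then $$\check s(G) \leq \sum_{d \in D(G)} \binom{\Delta(G)/2}{d/2}.$$
   Context: For a proper edge coloring $\varphi$ of a graph $G$, the palette $S(v,\varphi)$ of a vertex $v$ is the set of colors on the edges incident with $v$. The palette index $\check s(G)$ is the minimum, over all proper edge colorings $\varphi$ of $G$, of the number of distinct palettes $S(v,\varphi)$, $v\in V(G)$. -}

module Defs where

open import Data.Bool using (Bool; true; false; if_then_else_; _∧_; _∨_)
open import Data.Nat using (ℕ; zero; suc; _+_; _≤_; _⊔_; ⌊_/2⌋)
open import Data.Nat.Divisibility using (_∣_)
open import Data.Nat.Combinatorics using (_C_)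
import Data.Nat as ℕ
open import Data.Fin using (Fin)
import Data.Fin as Fin
open import Data.Fin.Subset using (Subset)
open import Data.List using (List; map; length; foldr; deduplicate; allFin)
open import Data.Nat.ListAction using (sum)
open import Data.Bool.ListAction using (any)
open import Data.Vec using (tabulate)
import Data.Vec.Properties as VecP
import Data.Bool.Properties as BoolP
open import Data.Product using (Σ; ∃; _×_)
open import Relation.Binary.PropositionalEquality using (_≡_; _≢_)
open import Relation.Nullary.Decidable using (⌊_⌋)

record Graph (n : ℕ) : Set where
  field
    adj    : Fin n → Fin n → Bool
    sym    : ∀ u v → adj u v ≡ adj v u
    irrefl : ∀ v → adj v v ≡ false
open Graph public

module _ {n : ℕ} (G : Graph n) where

  degree : Fin n → ℕ
  degree v = sum (map (λ u → if adj G v u then 1 else 0) (allFin n))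

  maxDegree : ℕ
  maxDegree = foldr _⊔_ 0 (map degree (allFin n))

  degreeSet : List ℕ
  degreeSet = deduplicate ℕ._≟_ (map degree (allFin n))

  Bipartite : Set
  Bipartite = Σ (Fin n → Bool) λ side → ∀ u v → adj G u v ≡ true → side u ≢ side v

  NoIsolatedVertices : Set
  NoIsolatedVertices = ∀ v → 1 ≤ degree v

  AllDegreesEven : Set
  AllDegreesEven = ∀ v → 2 ∣ degree v

  -- An edge colouring with colours in Fin m: c u v is the colour of edge uv
  -- (values on non-edges are irrelevant).
  EdgeColouring : ℕ → Set
  EdgeColouring m = Fin n → Fin n → Fin m

  -- proper: well defined on edges (symmetric) and adjacent edges get distinct colours
  Proper : {m : ℕ} → EdgeColouring m → Set
  Proper c = (∀ u v → adj G u v ≡ true → c u v ≡ c v u)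
           × (∀ v u w → adj G v u ≡ true → adj G v w ≡ true → c v u ≡ c v w → u ≡ w)

  palette : {m : ℕ} → EdgeColouring m → Fin n → Subset m
  palette c v = tabulate λ k → any (λ u → adj G v u ∧ ⌊ c v u Fin.≟ k ⌋) (allFin n)

  numPalettes : {m : ℕ} → EdgeColouring m → ℕ
  numPalettes {m} c = length (deduplicate (VecP.≡-dec BoolP._≟_) (map (palette c) (allFin n)))

  -- š(G) ≤ b : palette index is the minimum over proper colourings, so
  -- š(G) ≤ b iff some proper edge colouring has at most b distinct palettes
  PaletteIndex≤ : ℕ → Set
  PaletteIndex≤ b = ∃ λ m → Σ (EdgeColouring m) λ c → Proper c × numPalettes c ≤ b

  binomialBound : ℕ
  binomialBound = sum (map (λ d → ⌊ maxDegree /2⌋ C ⌊ d /2⌋) degreeSet)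

module Submission where

-- Proof, after Petersen's 2-factorisation argument.  Put k = Δ/2.
--  1. (Euler) Since all degrees are even, G has a balanced orientation O:
--     every vertex v has d(v)/2 out-arcs and d(v)/2 in-arcs.
--  2. Read O as a bipartite multigraph between tails and heads, i.e. as the
--     ℕ-matrix counting arcs u → w, and add k ∸ d(v)/2 loops (v, v): every
--     row and column sum becomes k.
--  3. (Kőnig) Such a matrix is a sum of k perfect matchings π₀, …, π_{k-1}.
--  4. Colour the edge uw, oriented u → w and lying in π_i, with (i, side of u).
--     The colouring is proper because the π_i are matchings and G is bipartite.
--     At v every π_i either is the loop at v or contributes one out-arc and one
--     in-arc, whose tails lie on opposite sides; so the palette of v is
--     {(i, s) : π_i avoids the loop at v}, fixed by a (d(v)/2)-subset of the k
--     matchings.  Counting such subsets over d ∈ D(G) gives the bound.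

module FiniteSums where

  open import Data.Bool using (Bool; true; false; not; _∧_; _∨_)
  open import Data.Bool.Properties using (¬-not) renaming (_≟_ to _≟ᵇ_)
  open import Data.Nat using (ℕ; zero; suc; _+_; _*_; _≤_; _<_; z≤n; s≤s)
  open import Data.Nat.Properties hiding (_≟_)
  open import Data.Fin using (Fin; zero; suc)
  open import Data.Fin.Properties using (_≟_; any?) renaming (suc-injective to Fin-suc-injective; 0≢1+n to Fin-0≢1+n)
  open import Data.Product using (∃; _,_)
  open import Data.Sum using (_⊎_; inj₁; inj₂)
  open import Function using (_∘_)
  open import Relation.Nullary using (yes; no; does; contradiction)
  open import Relation.Nullary.Decidable using (dec-true; dec-false)
  open import Relation.Binary.PropositionalEquality
  open import Algebra.Properties.Semiring.Sum +-*-semiring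
    using (sum; sum-syntax; sum-cong-≗; ∑-distrib-+; sum-replicate-zero)

  𝟙 : Bool → ℕ
  𝟙 true  = 1
  𝟙 false = 0

  true≢false : true ≢ false
  true≢false ()

  𝟙≤1 : ∀ b → 𝟙 b ≤ 1
  𝟙≤1 true  = s≤s z≤n
  𝟙≤1 false = z≤n

  𝟙≡0⇒false : ∀ {b} → 𝟙 b ≡ 0 → b ≡ false
  𝟙≡0⇒false {false} _ = refl

  𝟙>0⇒true : ∀ {b} → 0 < 𝟙 b → b ≡ true
  𝟙>0⇒true {true} _ = refl

  𝟙-∧ : ∀ a b → 𝟙 (a ∧ b) ≡ 𝟙 a * 𝟙 b
  𝟙-∧ true  b = sym (+-identityʳ (𝟙 b))
  𝟙-∧ false b = refl

  𝟙-∨-disjoint : ∀ a b → (b ≡ true → a ≡ false) → 𝟙 (a ∨ b) ≡ 𝟙 a + 𝟙 b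
  𝟙-∨-disjoint true  true  b⇒¬a = contradiction (b⇒¬a refl) true≢false
  𝟙-∨-disjoint true  false _    = refl
  𝟙-∨-disjoint false b     _    = refl

  bool-ext : ∀ {a b} → (a ≡ true → b ≡ true) → (b ≡ true → a ≡ true) → a ≡ b
  bool-ext {true}  {true}  _   _   = refl
  bool-ext {true}  {false} a⇒b _   = sym (a⇒b refl)
  bool-ext {false} {true}  _   b⇒a = b⇒a refl
  bool-ext {false} {false} _   _   = refl

  δ : ∀ {n} → Fin n → Fin n → ℕ
  δ i j = 𝟙 (does (i ≟ j))

  δ-refl : ∀ {n} (i : Fin n) → δ i i ≡ 1
  δ-refl i = cong 𝟙 (dec-true (i ≟ i) refl)

  δ-≢ : ∀ {n} {i j : Fin n} → i ≢ j → δ i j ≡ 0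
  δ-≢ {i = i} {j} i≢j = cong 𝟙 (dec-false (i ≟ j) i≢j)

  δ-sym : ∀ {n} (i j : Fin n) → δ i j ≡ δ j i
  δ-sym i j with i ≟ j | j ≟ i
  ... | yes _  | yes _  = refl
  ... | no  _  | no  _  = refl
  ... | yes eq | no neq = contradiction (sym eq) neq
  ... | no neq | yes eq = contradiction (sym eq) neq

  ∑-δ-select : ∀ {n} (j : Fin n) (f : Fin n → ℕ) → ∑[ i < n ] (δ i j * f i) ≡ f j
  ∑-δ-select {suc n} zero f =
    trans (cong₂ _+_ (+-identityʳ (f zero)) (sum-replicate-zero n)) (+-identityʳ (f zero))
  ∑-δ-select {suc n} (suc j) f = ∑-δ-select j (f ∘ suc)

  ∑-δ : ∀ {n} (j : Fin n) → ∑[ i < n ] δ i j ≡ 1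
  ∑-δ j = trans (sum-cong-≗ (λ i → sym (*-identityʳ (δ i j)))) (∑-δ-select j (λ _ → 1))

  ∑[1] : ∀ n → ∑[ i < n ] 1 ≡ n
  ∑[1] zero    = refl
  ∑[1] (suc n) = cong suc (∑[1] n)

  ∑-mono-≤ : ∀ {n} {f g : Fin n → ℕ} → (∀ i → f i ≤ g i) → sum f ≤ sum g
  ∑-mono-≤ {zero}  f≤g = z≤n
  ∑-mono-≤ {suc n} f≤g = +-mono-≤ (f≤g zero) (∑-mono-≤ (f≤g ∘ suc))

  term≤∑ : ∀ {n} (f : Fin n → ℕ) i → f i ≤ sum f
  term≤∑ f zero    = m≤m+n _ _
  term≤∑ f (suc i) = ≤-trans (term≤∑ (f ∘ suc) i) (m≤n+m _ _)

  two-terms≤∑ : ∀ {n} (f : Fin n → ℕ) {i j} → i ≢ j → f i + f j ≤ sum f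
  two-terms≤∑ f {zero}  {zero}  0≢0 = contradiction refl 0≢0
  two-terms≤∑ f {zero}  {suc j} _   = +-monoʳ-≤ (f zero) (term≤∑ (f ∘ suc) j)
  two-terms≤∑ f {suc i} {zero}  _   =
    subst (_≤ sum f) (+-comm (f zero) (f (suc i))) (+-monoʳ-≤ (f zero) (term≤∑ (f ∘ suc) i))
  two-terms≤∑ f {suc i} {suc j} i≢j =
    ≤-trans (two-terms≤∑ (f ∘ suc) (i≢j ∘ cong suc)) (m≤n+m _ (f zero))

  ∑≡0⇒≡0 : ∀ {n} (f : Fin n → ℕ) → sum f ≡ 0 → ∀ i → f i ≡ 0
  ∑≡0⇒≡0 f ∑f≡0 i = n≤0⇒n≡0 (subst (f i ≤_) ∑f≡0 (term≤∑ f i))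

  ∑-positive : ∀ {n} (f : Fin n → ℕ) → 0 < sum f → ∃ λ i → 0 < f i
  ∑-positive {suc n} f 0<∑ with f zero in f0≡
  ... | suc _ = zero , subst (0 <_) (sym f0≡) (s≤s z≤n)
  ... | zero  with ∑-positive (f ∘ suc) 0<∑
  ...   | i , 0<fi = suc i , 0<fi

  all-one : ∀ {n} (f : Fin n → ℕ) → (∀ i → f i ≤ 1) → n ≤ sum f → ∀ i → f i ≡ 1
  all-one {suc n} f f≤1 n≤∑ zero = ≤-antisym (f≤1 zero) (+-cancelʳ-≤ n 1 (f zero) 1+n≤f0+n)
    where
    1+n≤f0+n : 1 + n ≤ f zero + n
    1+n≤f0+n = ≤-trans n≤∑ (+-monoʳ-≤ (f zero)
                 (≤-trans (∑-mono-≤ (f≤1 ∘ suc)) (≤-reflexive (∑[1] n))))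
  all-one {suc n} f f≤1 n≤∑ (suc i) = all-one (f ∘ suc) (f≤1 ∘ suc) n≤∑tail i
    where
    n≤∑tail : n ≤ sum (f ∘ suc)
    n≤∑tail = +-cancelˡ-≤ 1 n _ (≤-trans n≤∑ (+-monoˡ-≤ _ (f≤1 zero)))

  count : ∀ {n} → (Fin n → Bool) → ℕ
  count {n} p = ∑[ i < n ] 𝟙 (p i)

  count-not : ∀ {n} (p : Fin n → Bool) → count (not ∘ p) + count p ≡ n
  count-not {n} p =
    trans (sym (∑-distrib-+ (𝟙 ∘ not ∘ p) (𝟙 ∘ p))) (trans (sum-cong-≗ (λ i → complement (p i))) (∑[1] n))
    where
    complement : ∀ b → 𝟙 (not b) + 𝟙 b ≡ 1
    complement true  = refl
    complement false = refl

  AtMostOne : ∀ {n} → (Fin n → Bool) → Set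
  AtMostOne p = ∀ i j → p i ≡ true → p j ≡ true → i ≡ j

  atMostOne⇒count≤1 : ∀ {n} (p : Fin n → Bool) → AtMostOne p → count p ≤ 1
  atMostOne⇒count≤1 {zero}  p uniq = z≤n
  atMostOne⇒count≤1 {suc n} p uniq with p zero in p0
  ... | false = atMostOne⇒count≤1 (p ∘ suc) (λ i j pi pj → Fin-suc-injective (uniq (suc i) (suc j) pi pj))
  ... | true  = ≤-reflexive (cong suc (trans (sum-cong-≗ (cong 𝟙 ∘ tail-false)) (sum-replicate-zero n)))
    where
    tail-false : ∀ i → p (suc i) ≡ false
    tail-false i = ¬-not (λ pi → Fin-0≢1+n (uniq zero (suc i) p0 pi))

  count≤1⇒atMostOne : ∀ {n} (p : Fin n → Bool) → count p ≤ 1 → AtMostOne p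
  count≤1⇒atMostOne p c≤1 i j pi pj with i ≟ j
  ... | yes i≡j = i≡j
  ... | no  i≢j = contradiction (≤-trans two≤count c≤1) (λ { (s≤s ()) })
    where
    two≤count : 2 ≤ count p
    two≤count = subst (_≤ count p) (cong₂ _+_ (cong 𝟙 pi) (cong 𝟙 pj)) (two-terms≤∑ (𝟙 ∘ p) i≢j)

  search : ∀ {n} (p : Fin n → Bool) → (∃ λ i → p i ≡ true) ⊎ (∀ i → p i ≡ false)
  search p with any? (λ i → p i ≟ᵇ true)
  ... | yes found = inj₁ found
  ... | no  none  = inj₂ (λ i → ¬-not (λ pi → none (i , pi)))

module Iteration where

  open import Data.Nat using (ℕ; zero; suc; _+_; _∸_; _≤_; _<_)
  open import Data.Nat.Properties
  open import Data.Nat.GeneralisedArithmetic using (fold; fold-+)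
  open import Data.Fin using (Fin; toℕ)
  open import Data.Fin.Properties using (pigeonhole; toℕ<n)
  open import Data.Product using (_,_)
  open import Relation.Binary.PropositionalEquality

  fold-fixed : ∀ {A : Set} (f : A → A) {y} → f y ≡ y → ∀ j → fold y f j ≡ y
  fold-fixed f fy≡y zero    = refl
  fold-fixed f fy≡y (suc j) = trans (cong f (fold-fixed f fy≡y j)) fy≡y

  fold-shift : ∀ {A : Set} (f : A → A) x j → fold (f x) f j ≡ f (fold x f j)
  fold-shift f x zero    = refl
  fold-shift f x (suc j) = cong f (fold-shift f x j)

  -- If A embeds into Fin N and y is a fixed point of f, an orbit that reaches y
  -- does so within N steps: among the N + 1 points x, f x, …, fᴺ x two coincide,
  -- so the orbit is periodic from some index ≤ N on, and fᴺ x already lies in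
  -- the periodic part, which is {y}.
  reach-within : ∀ {A : Set} {N} (enc : A → Fin N) → (∀ {a b} → enc a ≡ enc b → a ≡ b)
               → (f : A → A) {y : A} → f y ≡ y
               → ∀ x → fold x f (suc N) ≡ y → fold x f N ≡ y
  reach-within {N = N} enc enc-inj f {y} fy≡y x reached
    with pigeonhole (n<1+n N) (λ j → enc (fold x f (toℕ j)))
  ... | i , j , i<j , same = begin
    fold x f N                 ≡⟨ cong (fold x f) (sym (m∸n+n≡m a≤N)) ⟩
    fold x f (t + a)           ≡⟨ fold-+ x f t ⟩
    fold (fold x f a) f t      ≡⟨ cong (λ z → fold z f t) (enc-inj same) ⟩
    fold (fold x f b) f t      ≡⟨ sym (fold-+ x f t) ⟩
    fold x f (t + b)           ≡⟨ cong (fold x f) (sym (m∸n+n≡m N<t+b)) ⟩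
    fold x f (s + suc N)       ≡⟨ fold-+ x f s ⟩
    fold (fold x f (suc N)) f s ≡⟨ cong (λ z → fold z f s) reached ⟩
    fold y f s                 ≡⟨ fold-fixed f fy≡y s ⟩
    y                          ∎
    where
    open ≡-Reasoning
    a b : ℕ
    a = toℕ i
    b = toℕ j
    a≤N : a ≤ N
    a≤N = ≤-trans (<⇒≤ i<j) (≤-pred (toℕ<n j))
    t : ℕ
    t = N ∸ a
    N<t+b : suc N ≤ t + b
    N<t+b = subst (_≤ t + b) (trans (+-suc t a) (cong suc (m∸n+n≡m a≤N))) (+-monoʳ-≤ t i<j)
    s : ℕ
    s = t + b ∸ suc N

module Matrices where

  open import Data.Nat using (ℕ; suc; _+_; _*_; _∸_; _≤_; _<_; z≤n)
  open import Data.Nat.Properties hiding (_≟_)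
  open import Data.Fin using (Fin)
  open import Data.Fin.Properties using (_≟_)
  open import Data.Product using (∃; _×_; _,_)
  open import Data.Sum using (_⊎_; inj₁; inj₂)
  open import Relation.Nullary using (yes; no)
  open import Relation.Binary.PropositionalEquality
  open import Algebra.Properties.Semiring.Sum +-*-semiring
    using (sum; sum-syntax; sum-cong-≗; ∑-distrib-+; *-distribˡ-sum)
  open FiniteSums

  -- Square ℕ-matrices indexed by Fin n.  A symmetric one is a multigraph on
  -- Fin n; an arbitrary one is a bipartite multigraph between rows and columns.
  Matrix : ℕ → Set
  Matrix n = Fin n → Fin n → ℕ

  module _ {n : ℕ} where

    _≐_ : Matrix n → Matrix n → Set
    A ≐ B = ∀ r c → A r c ≡ B r c

    _⊕_ : Matrix n → Matrix n → Matrix n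
    (A ⊕ B) r c = A r c + B r c

    _⊖_ : Matrix n → Matrix n → Matrix n
    (S ⊖ X) r c = S r c ∸ X r c

    ⊖-⊕ : ∀ S X → (∀ r c → X r c ≤ S r c) → S ≐ ((S ⊖ X) ⊕ X)
    ⊖-⊕ S X X≤S r c = sym (m∸n+n≡m (X≤S r c))

    rowSum : Matrix n → Fin n → ℕ
    rowSum M r = ∑[ c < n ] M r c

    colSum : Matrix n → Fin n → ℕ
    colSum M c = ∑[ r < n ] M r c

    total : Matrix n → ℕ
    total M = ∑[ r < n ] rowSum M r

    rowSum-≐ : ∀ {A B} → A ≐ B → ∀ r → rowSum A r ≡ rowSum B r
    rowSum-≐ A≐B r = sum-cong-≗ (A≐B r)

    colSum-≐ : ∀ {A B} → A ≐ B → ∀ c → colSum A c ≡ colSum B c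
    colSum-≐ A≐B c = sum-cong-≗ (λ r → A≐B r c)

    total-≐ : ∀ {A B} → A ≐ B → total A ≡ total B
    total-≐ A≐B = sum-cong-≗ (rowSum-≐ A≐B)

    rowSum-⊕ : ∀ A B r → rowSum (A ⊕ B) r ≡ rowSum A r + rowSum B r
    rowSum-⊕ A B r = ∑-distrib-+ (A r) (B r)

    colSum-⊕ : ∀ A B c → colSum (A ⊕ B) c ≡ colSum A c + colSum B c
    colSum-⊕ A B c = ∑-distrib-+ (λ r → A r c) (λ r → B r c)

    total-⊕ : ∀ A B → total (A ⊕ B) ≡ total A + total B
    total-⊕ A B = trans (sum-cong-≗ (rowSum-⊕ A B)) (∑-distrib-+ (rowSum A) (rowSum B))

    total≡0 : ∀ M → total M ≡ 0 → ∀ r c → M r c ≡ 0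
    total≡0 M empty r = ∑≡0⇒≡0 (M r) (∑≡0⇒≡0 (rowSum M) empty r)

    positive-entry : ∀ M → 0 < total M → ∃ λ x → ∃ λ y → 0 < M x y
    positive-entry M 0<total with ∑-positive (rowSum M) 0<total
    ... | x , 0<row with ∑-positive (M x) 0<row
    ...   | y , 0<Mxy = x , y , 0<Mxy

    unit : Fin n → Fin n → Matrix n
    unit x y r c = δ r x * δ c y

    unit-cases : ∀ x y r c → (r ≡ x × c ≡ y × unit x y r c ≡ 1) ⊎ unit x y r c ≡ 0
    unit-cases x y r c with r ≟ x | c ≟ y
    ... | yes r≡x | yes c≡y = inj₁ (r≡x , c≡y , refl)
    ... | yes _   | no  _   = inj₂ refl
    ... | no  _   | _       = inj₂ refl

    unit-transpose : ∀ x y r c → unit x y r c ≡ unit y x c r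
    unit-transpose x y r c = *-comm (δ r x) (δ c y)

    rowSum-unit : ∀ x y r → rowSum (unit x y) r ≡ δ r x
    rowSum-unit x y r = begin
      ∑[ c < n ] (δ r x * δ c y) ≡⟨ *-distribˡ-sum (δ r x) (λ c → δ c y) ⟨
      δ r x * ∑[ c < n ] δ c y   ≡⟨ cong (δ r x *_) (∑-δ y) ⟩
      δ r x * 1                  ≡⟨ *-identityʳ (δ r x) ⟩
      δ r x                      ∎
      where open ≡-Reasoning

    colSum-unit : ∀ x y c → colSum (unit x y) c ≡ δ c y
    colSum-unit x y c = begin
      ∑[ r < n ] (δ r x * δ c y) ≡⟨ sum-cong-≗ (λ r → *-comm (δ r x) (δ c y)) ⟩
      ∑[ r < n ] (δ c y * δ r x) ≡⟨ *-distribˡ-sum (δ c y) (λ r → δ r x) ⟨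
      δ c y * ∑[ r < n ] δ r x   ≡⟨ cong (δ c y *_) (∑-δ x) ⟩
      δ c y * 1                  ≡⟨ *-identityʳ (δ c y) ⟩
      δ c y                      ∎
      where open ≡-Reasoning

    total-unit : ∀ x y → total (unit x y) ≡ 1
    total-unit x y = trans (sum-cong-≗ (rowSum-unit x y)) (∑-δ x)

    decrement : Matrix n → Fin n → Fin n → Matrix n
    decrement M x y = M ⊖ unit x y

    decrement-≤ : ∀ M x y r c → decrement M x y r c ≤ M r c
    decrement-≤ M x y r c = m∸n≤m (M r c) (unit x y r c)

    decrement-⊕ : ∀ M x y → 0 < M x y → M ≐ (decrement M x y ⊕ unit x y)
    decrement-⊕ M x y 0<M = ⊖-⊕ M (unit x y) unit≤M
      where
      unit≤M : ∀ r c → unit x y r c ≤ M r c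
      unit≤M r c with unit-cases x y r c
      ... | inj₁ (refl , refl , u≡1) = subst (_≤ M x y) (sym u≡1) 0<M
      ... | inj₂ u≡0                 = subst (_≤ M r c) (sym u≡0) z≤n

    module _ (M : Matrix n) (x y : Fin n) (0<M : 0 < M x y) where

      private
        M′ : Matrix n
        M′ = decrement M x y

      rowSum-decrement : rowSum M x ≡ suc (rowSum M′ x)
      rowSum-decrement = begin
        rowSum M x                           ≡⟨ rowSum-≐ (decrement-⊕ M x y 0<M) x ⟩
        rowSum (M′ ⊕ unit x y) x             ≡⟨ rowSum-⊕ M′ (unit x y) x ⟩
        rowSum M′ x + rowSum (unit x y) x    ≡⟨ cong (rowSum M′ x +_) (trans (rowSum-unit x y x) (δ-refl x)) ⟩
        rowSum M′ x + 1                      ≡⟨ +-comm (rowSum M′ x) 1 ⟩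
        suc (rowSum M′ x)                    ∎
        where open ≡-Reasoning

      colSum-decrement : colSum M y ≡ suc (colSum M′ y)
      colSum-decrement = begin
        colSum M y                           ≡⟨ colSum-≐ (decrement-⊕ M x y 0<M) y ⟩
        colSum (M′ ⊕ unit x y) y             ≡⟨ colSum-⊕ M′ (unit x y) y ⟩
        colSum M′ y + colSum (unit x y) y    ≡⟨ cong (colSum M′ y +_) (trans (colSum-unit x y y) (δ-refl y)) ⟩
        colSum M′ y + 1                      ≡⟨ +-comm (colSum M′ y) 1 ⟩
        suc (colSum M′ y)                    ∎
        where open ≡-Reasoning

      total-decrement : total M ≡ suc (total M′)
      total-decrement = begin
        total M                              ≡⟨ total-≐ (decrement-⊕ M x y 0<M) ⟩
        total (M′ ⊕ unit x y)                ≡⟨ total-⊕ M′ (unit x y) ⟩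
        total M′ + total (unit x y)          ≡⟨ cong (total M′ +_) (total-unit x y) ⟩
        total M′ + 1                         ≡⟨ +-comm (total M′) 1 ⟩
        suc (total M′)                       ∎
        where open ≡-Reasoning

-- Kőnig's edge-colouring theorem for bipartite multigraphs, as a statement
-- about ℕ-matrices.
module KonigColouring where

  open import Data.Bool using (Bool; true; false; if_then_else_; _∨_; _∧_)
  open import Data.Bool.Properties using (¬-not)
  open import Data.Nat using (ℕ; zero; suc; _+_; _*_; _≤_; _<_; z≤n; s≤s)
  open import Data.Nat.Properties hiding (_≟_)
  import Data.Nat.Properties as ℕₚ
  open import Data.Nat.GeneralisedArithmetic using (fold)
  open import Data.Fin using (Fin; join; splitAt)
  open import Data.Fin.Properties using (_≟_; any?; splitAt-join)
  open import Data.Fin.Permutation using (transpose)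
  import Data.Fin.Permutation.Components as PC
  open import Data.Product using (∃; _×_; _,_; proj₁; proj₂)
  import Data.Product as Product
  open import Data.Sum using (_⊎_; inj₁; inj₂)
  import Data.Sum.Properties as Sumₚ
  open import Function using (_∘_; mk⇔)
  open import Data.Empty using (⊥; ⊥-elim)
  open import Relation.Nullary using (yes; no; does; contradiction)
  open import Relation.Nullary.Decidable using (dec-true; does-⇔)
  open import Relation.Binary.PropositionalEquality
  open import Relation.Binary.Definitions using (DecidableEquality)
  open import Algebra.Properties.Semiring.Sum +-*-semiring
    using (sum; sum-syntax; sum-cong-≗; ∑-comm; ∑-distrib-+; sum-permute; sum-replicate-zero)
  open FiniteSums
  open Matrices
  open Iteration

  unused-colour : ∀ {k n} (h : Fin k → Fin n → Bool) → ∑[ c < n ] count (λ i → h i c) < k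
                → ∃ λ α → ∀ c → h α c ≡ false
  unused-colour {k} {n} h marks<k with any? (λ i → count (h i) ℕₚ.≟ 0)
  ... | yes (α , none) = α , λ c → 𝟙≡0⇒false (∑≡0⇒≡0 (𝟙 ∘ h α) none c)
  ... | no  all-used   = contradiction marks<k (≤⇒≯ k≤marks)
    where
    open ≤-Reasoning
    k≤marks : k ≤ ∑[ c < n ] count (λ i → h i c)
    k≤marks = begin
      k                               ≡⟨ sym (∑[1] k) ⟩
      ∑[ i < k ] 1                    ≤⟨ ∑-mono-≤ (λ i → n≢0⇒n>0 (λ c≡0 → all-used (i , c≡0))) ⟩
      ∑[ i < k ] count (h i)          ≡⟨ ∑-comm (λ i c → 𝟙 (h i c)) ⟩
      ∑[ c < n ] count (λ i → h i c)  ∎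

  module MatrixColouring (k n : ℕ) where

    Colouring : Set
    Colouring = Fin k → Fin n → Fin n → Bool

    Matchings : Colouring → Set
    Matchings π = ∀ i → (∀ r → AtMostOne (π i r)) × (∀ c → AtMostOne (λ r → π i r c))

    multiplicity : Colouring → Matrix n
    multiplicity π r c = count (λ i → π i r c)

    -- Kempe-chain interchange.
    -- Walking from a row along its α-entry and from a column along its β-entry
    -- traces the α/β-chains; swapping α and β on the rows whose walk ends at
    -- column y keeps all colour classes matchings and makes α missing at y too.
    module KempeSwap (π : Colouring) (match : Matchings π) (x y : Fin n) (α β : Fin k)
                     (α∉x : ∀ c → π α x c ≡ false) (β∉y : ∀ r → π β r y ≡ false) where

      -- Rows (inj₁) and columns (inj₂) of the matrix.
      Vertex : Set
      Vertex = Fin n ⊎ Fin n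

      _≟ᵥ_ : DecidableEquality Vertex
      _≟ᵥ_ = Sumₚ.≡-dec _≟_ _≟_

      encode-injective : ∀ {u v} → join n n u ≡ join n n v → u ≡ v
      encode-injective {u} {v} eq =
        trans (sym (splitAt-join n n u)) (trans (cong (splitAt n) eq) (splitAt-join n n v))

      step : Vertex → Vertex
      step (inj₁ r) with search (π α r)
      ... | inj₁ (c , _) = inj₂ c
      ... | inj₂ _       = inj₁ r
      step (inj₂ c) with search (λ r → π β r c)
      ... | inj₁ (r , _) = inj₁ r
      ... | inj₂ _       = inj₂ c

      step-α : ∀ {r c} → π α r c ≡ true → step (inj₁ r) ≡ inj₂ c
      step-α {r} {c} p with search (π α r)
      ... | inj₁ (c′ , q) = cong inj₂ (proj₁ (match α) r c′ c q p)
      ... | inj₂ none     = contradiction (trans (sym p) (none c)) true≢false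

      step-β : ∀ {r c} → π β r c ≡ true → step (inj₂ c) ≡ inj₁ r
      step-β {r} {c} p with search (λ r → π β r c)
      ... | inj₁ (r′ , q) = cong inj₁ (proj₂ (match β) c r′ r q p)
      ... | inj₂ none     = contradiction (trans (sym p) (none r)) true≢false

      step-x : step (inj₁ x) ≡ inj₁ x
      step-x with search (π α x)
      ... | inj₁ (c , q) = contradiction (trans (sym q) (α∉x c)) true≢false
      ... | inj₂ _       = refl

      step-y : step (inj₂ y) ≡ inj₂ y
      step-y with search (λ r → π β r y)
      ... | inj₁ (r , q) = contradiction (trans (sym q) (β∉y r)) true≢false
      ... | inj₂ _       = refl

      -- v lies on the chain ending at column y: its walk reaches y (within 2n steps).
      inChain : Vertex → Bool
      inChain v = does (fold v step (n + n) ≟ᵥ inj₂ y)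

      inChain-step : ∀ v → inChain (step v) ≡ inChain v
      inChain-step v = does-⇔ (mk⇔ later earlier) (fold (step v) step (n + n) ≟ᵥ inj₂ y) (fold v step (n + n) ≟ᵥ inj₂ y)
        where
        later : fold (step v) step (n + n) ≡ inj₂ y → fold v step (n + n) ≡ inj₂ y
        later reached = reach-within (join n n) encode-injective step step-y v
                          (trans (sym (fold-shift step v (n + n))) reached)
        earlier : fold v step (n + n) ≡ inj₂ y → fold (step v) step (n + n) ≡ inj₂ y
        earlier reached = trans (fold-shift step v (n + n)) (trans (cong step reached) step-y)

      inChain-α : ∀ {r c} → π α r c ≡ true → inChain (inj₁ r) ≡ inChain (inj₂ c)
      inChain-α p = trans (sym (inChain-step _)) (cong inChain (step-α p))

      inChain-β : ∀ {r c} → π β r c ≡ true → inChain (inj₁ r) ≡ inChain (inj₂ c)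
      inChain-β p = trans (cong inChain (sym (step-β p))) (inChain-step _)

      x∉chain : inChain (inj₁ x) ≡ false
      x∉chain = cong (λ v → does (v ≟ᵥ inj₂ y)) (fold-fixed step step-x (n + n))

      y∈chain : inChain (inj₂ y) ≡ true
      y∈chain = trans (cong (λ v → does (v ≟ᵥ inj₂ y)) (fold-fixed step step-y (n + n)))
                      (dec-true (inj₂ y ≟ᵥ inj₂ y) refl)

      swap : Fin k → Fin k
      swap = PC.transpose α β

      swap-cases : ∀ i → (i ≡ α × swap i ≡ β) ⊎ (i ≡ β × swap i ≡ α) ⊎ swap i ≡ i
      swap-cases i with i ≟ α
      ... | yes i≡α = inj₁ (i≡α , refl)
      ... | no  _ with i ≟ β
      ...   | yes i≡β = inj₂ (inj₁ (i≡β , refl))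
      ...   | no  _   = inj₂ (inj₂ refl)

      swap-α : swap α ≡ β
      swap-α rewrite dec-true (α ≟ α) refl = refl

      swapped : Colouring
      swapped i r c = if inChain (inj₁ r) then π (swap i) r c else π i r c

      multiplicity-swapped : ∀ r c → multiplicity swapped r c ≡ multiplicity π r c
      multiplicity-swapped r c with inChain (inj₁ r)
      ... | true  = sym (sum-permute (λ i → 𝟙 (π i r c)) (transpose α β))
      ... | false = refl

      -- A column cannot see colour i from a chain row (after swapping) and from a
      -- non-chain row: both rows would share the chain membership of the column.
      no-mixed-column : ∀ i c {r r′} → inChain (inj₁ r) ≡ true → inChain (inj₁ r′) ≡ false
                      → π (swap i) r c ≡ true → π i r′ c ≡ true → ⊥
      no-mixed-column i c {r} {r′} r∈ r′∉ p q with swap-cases i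
      ... | inj₁ (refl , s≡β) = true≢false (begin
            true               ≡⟨ sym r∈ ⟩
            inChain (inj₁ r)   ≡⟨ inChain-β (subst (λ j → π j r c ≡ true) s≡β p) ⟩
            inChain (inj₂ c)   ≡⟨ sym (inChain-α q) ⟩
            inChain (inj₁ r′)  ≡⟨ r′∉ ⟩
            false              ∎)
        where open ≡-Reasoning
      ... | inj₂ (inj₁ (refl , s≡α)) = true≢false (begin
            true               ≡⟨ sym r∈ ⟩
            inChain (inj₁ r)   ≡⟨ inChain-α (subst (λ j → π j r c ≡ true) s≡α p) ⟩
            inChain (inj₂ c)   ≡⟨ sym (inChain-β q) ⟩
            inChain (inj₁ r′)  ≡⟨ r′∉ ⟩
            false              ∎)
        where open ≡-Reasoning
      ... | inj₂ (inj₂ s≡i) = true≢false (trans (sym r∈) (trans (cong (inChain ∘ inj₁) r≡r′) r′∉))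
        where
        r≡r′ : r ≡ r′
        r≡r′ = proj₂ (match i) c r r′ (subst (λ j → π j r c ≡ true) s≡i p) q

      matchings-swapped : Matchings swapped
      matchings-swapped i = row-unique , column-unique
        where
        row-unique : ∀ r → AtMostOne (swapped i r)
        row-unique r with inChain (inj₁ r)
        ... | true  = proj₁ (match (swap i)) r
        ... | false = proj₁ (match i) r
        column-unique : ∀ c → AtMostOne (λ r → swapped i r c)
        column-unique c r r′ p q with inChain (inj₁ r) in r∈ | inChain (inj₁ r′) in r′∈
        ... | true  | true  = proj₂ (match (swap i)) c r r′ p q
        ... | false | false = proj₂ (match i) c r r′ p q
        ... | true  | false = ⊥-elim (no-mixed-column i c r∈ r′∈ p q)
        ... | false | true  = ⊥-elim (no-mixed-column i c r′∈ r∈ q p)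

      α∉x-swapped : ∀ c → swapped α x c ≡ false
      α∉x-swapped c rewrite x∉chain = α∉x c

      α∉y-swapped : ∀ r → swapped α r y ≡ false
      α∉y-swapped r with inChain (inj₁ r) in r∈
      ... | true  = subst (λ j → π j r y ≡ false) (sym swap-α) (β∉y r)
      ... | false = ¬-not λ p → true≢false (trans (sym y∈chain) (trans (sym (inChain-α p)) r∈))

    module AddEntry (π : Colouring) (match : Matchings π) (x y : Fin n) (α : Fin k)
                    (α∉x : ∀ c → π α x c ≡ false) (α∉y : ∀ r → π α r y ≡ false) where

      isNew : Fin k → Fin n → Fin n → Bool
      isNew i r c = does (i ≟ α) ∧ (does (r ≟ x) ∧ does (c ≟ y))

      isNew-cases : ∀ {i r c} → isNew i r c ≡ true → i ≡ α × r ≡ x × c ≡ y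
      isNew-cases {i} {r} {c} new with i ≟ α | r ≟ x | c ≟ y
      ... | yes i≡α | yes r≡x | yes c≡y = i≡α , r≡x , c≡y

      isNew-fresh : ∀ {i r c} → isNew i r c ≡ true → π i r c ≡ false
      isNew-fresh {i} {r} {c} new with isNew-cases {i} {r} {c} new
      ... | refl , refl , refl = α∉x y

      extended : Colouring
      extended i r c = π i r c ∨ isNew i r c

      extended-cases : ∀ {i r c} → extended i r c ≡ true → π i r c ≡ true ⊎ (i ≡ α × r ≡ x × c ≡ y)
      extended-cases {i} {r} {c} p with π i r c in old
      ... | true  = inj₁ refl
      ... | false = inj₂ (isNew-cases p)

      matchings-extended : Matchings extended
      matchings-extended i = row-unique , column-unique
        where
        row-unique : ∀ r → AtMostOne (extended i r)
        row-unique r c c′ p q with extended-cases p | extended-cases q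
        ... | inj₁ p′ | inj₁ q′                       = proj₁ (match i) r c c′ p′ q′
        ... | inj₁ p′ | inj₂ (refl , refl , _)        = contradiction (trans (sym p′) (α∉x c)) true≢false
        ... | inj₂ (refl , refl , _) | inj₁ q′        = contradiction (trans (sym q′) (α∉x c′)) true≢false
        ... | inj₂ (_ , _ , c≡y) | inj₂ (_ , _ , c′≡y) = trans c≡y (sym c′≡y)
        column-unique : ∀ c → AtMostOne (λ r → extended i r c)
        column-unique c r r′ p q with extended-cases p | extended-cases q
        ... | inj₁ p′ | inj₁ q′                       = proj₂ (match i) c r r′ p′ q′
        ... | inj₁ p′ | inj₂ (refl , _ , refl)        = contradiction (trans (sym p′) (α∉y r)) true≢false
        ... | inj₂ (refl , _ , refl) | inj₁ q′        = contradiction (trans (sym q′) (α∉y r′)) true≢false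
        ... | inj₂ (_ , r≡x , _) | inj₂ (_ , r′≡x , _) = trans r≡x (sym r′≡x)

      multiplicity-extended : ∀ r c → multiplicity extended r c ≡ multiplicity π r c + unit x y r c
      multiplicity-extended r c = begin
        ∑[ i < k ] 𝟙 (π i r c ∨ isNew i r c)                  ≡⟨ sum-cong-≗ (λ i → 𝟙-∨-disjoint (π i r c) (isNew i r c) (isNew-fresh {i} {r} {c})) ⟩
        ∑[ i < k ] (𝟙 (π i r c) + 𝟙 (isNew i r c))            ≡⟨ ∑-distrib-+ (λ i → 𝟙 (π i r c)) _ ⟩
        multiplicity π r c + ∑[ i < k ] 𝟙 (isNew i r c)       ≡⟨ cong (multiplicity π r c +_) (sum-cong-≗ 𝟙-isNew) ⟩
        multiplicity π r c + ∑[ i < k ] (δ i α * unit x y r c) ≡⟨ cong (multiplicity π r c +_) (∑-δ-select α (λ _ → unit x y r c)) ⟩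
        multiplicity π r c + unit x y r c                      ∎
        where
        open ≡-Reasoning
        𝟙-isNew : ∀ i → 𝟙 (isNew i r c) ≡ δ i α * unit x y r c
        𝟙-isNew i = trans (𝟙-∧ (does (i ≟ α)) _) (cong (δ i α *_) (𝟙-∧ (does (r ≟ x)) (does (c ≟ y))))

    colour-one-more : ∀ M x y → 0 < M x y
                    → (∀ r → rowSum M r ≤ k) → (∀ c → colSum M c ≤ k)
                    → (π : Colouring) → Matchings π → (∀ r c → multiplicity π r c ≡ decrement M x y r c)
                    → ∃ λ π′ → Matchings π′ × (∀ r c → multiplicity π′ r c ≡ M r c)
    colour-one-more M x y 0<M rows≤k cols≤k π match counts =
      extended , matchings-extended , λ r c → begin
        multiplicity extended r c                   ≡⟨ multiplicity-extended r c ⟩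
        multiplicity swapped r c + unit x y r c     ≡⟨ cong (_+ unit x y r c) (multiplicity-swapped r c) ⟩
        multiplicity π r c + unit x y r c           ≡⟨ cong (_+ unit x y r c) (counts r c) ⟩
        decrement M x y r c + unit x y r c          ≡⟨ sym (decrement-⊕ M x y 0<M r c) ⟩
        M r c                                       ∎
      where
      open ≡-Reasoning
      row-x-not-full : ∑[ c < n ] count (λ i → π i x c) < k
      row-x-not-full = subst (_≤ k) (trans (rowSum-decrement M x y 0<M) (cong suc (sym (sum-cong-≗ (counts x)))))
                         (rows≤k x)
      column-y-not-full : ∑[ r < n ] count (λ i → π i r y) < k
      column-y-not-full = subst (_≤ k) (trans (colSum-decrement M x y 0<M) (cong suc (sym (sum-cong-≗ (λ r → counts r y)))))
                            (cols≤k y)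
      α-missing : ∃ λ α → ∀ c → π α x c ≡ false
      α-missing = unused-colour (λ i c → π i x c) row-x-not-full
      β-missing : ∃ λ β → ∀ r → π β r y ≡ false
      β-missing = unused-colour (λ i r → π i r y) column-y-not-full
      α : Fin k
      α = proj₁ α-missing
      open KempeSwap π match x y α (proj₁ β-missing) (proj₂ α-missing) (proj₂ β-missing)
      open AddEntry swapped matchings-swapped x y α α∉x-swapped α∉y-swapped

    konig : ∀ (M : Matrix n) → (∀ r → rowSum M r ≤ k) → (∀ c → colSum M c ≤ k)
          → ∃ λ π → Matchings π × (∀ r c → multiplicity π r c ≡ M r c)
    konig M = by-total (total M) M refl
      where
      by-total : ∀ T M → total M ≡ T → (∀ r → rowSum M r ≤ k) → (∀ c → colSum M c ≤ k)
               → ∃ λ π → Matchings π × (∀ r c → multiplicity π r c ≡ M r c)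
      by-total zero M empty _ _ =
        (λ _ _ _ → false) , (λ _ → (λ _ _ _ ()) , (λ _ _ _ ())) ,
        λ r c → trans (sum-replicate-zero k) (sym (total≡0 M empty r c))
      by-total (suc T) M total≡1+T rows≤k cols≤k
        with positive-entry M (subst (0 <_) (sym total≡1+T) (s≤s z≤n))
      ... | x , y , 0<M with by-total T (decrement M x y)
                            (suc-injective (trans (sym (total-decrement M x y 0<M)) total≡1+T))
                            (λ r → ≤-trans (∑-mono-≤ (decrement-≤ M x y r)) (rows≤k r))
                            (λ c → ≤-trans (∑-mono-≤ (λ r → decrement-≤ M x y r c)) (cols≤k c))
      ...   | π , match , counts = colour-one-more M x y 0<M rows≤k cols≤k π match counts

    meets-every-row : ∀ π → Matchings π → ∀ r → rowSum (multiplicity π) r ≡ k → ∀ i → ∃ λ c → π i r c ≡ true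
    meets-every-row π match r row≡k i with search (π i r)
    ... | inj₁ found = found
    ... | inj₂ none  = contradiction (trans (sym (sum-replicate-zero n)) (sum-cong-≗ (λ c → sym (cong 𝟙 (none c))))) 0≢count
      where
      classes : ∑[ j < k ] count (π j r) ≡ k
      classes = trans (∑-comm (λ j c → 𝟙 (π j r c))) row≡k
      0≢count : 0 ≢ count (π i r)
      0≢count 0≡ = 0≢1+n (trans 0≡ (all-one (λ j → count (π j r)) (λ j → atMostOne⇒count≤1 (π j r) (proj₁ (match j) r))
                                     (≤-reflexive (sym classes)) i))

    transposed : Colouring → Colouring
    transposed π i r c = π i c r

    meets-every-column : ∀ π → Matchings π → ∀ c → colSum (multiplicity π) c ≡ k → ∀ i → ∃ λ r → π i r c ≡ true
    meets-every-column π match = meets-every-row (transposed π) (λ i → Product.swap (match i))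

-- Euler's theorem in the form: every loopless multigraph with even degrees has
-- an orientation with equal in- and out-degree at every vertex.
module EulerOrientation where

  open import Data.Nat using (ℕ; zero; suc; _+_; _*_; _∸_; _≤_; _<_; z≤n; s≤s)
  open import Data.Nat.Properties hiding (_≟_)
  open import Data.Nat.Properties using () renaming (_≟_ to _ℕ≟_)
  open import Data.Nat.Divisibility using (_∣_; divides; ∣1⇒≡1; ∣m+n∣m⇒∣n)
  open import Data.Nat.Induction using (<-rec)
  open import Data.Nat.Tactic.RingSolver using (solve-∀)
  open import Data.Fin using (Fin)
  open import Data.Fin.Properties using (_≟_)
  open import Data.Product using (∃; _×_; _,_; proj₁; proj₂)
  open import Data.Sum using (inj₁; inj₂)
  open import Relation.Nullary using (yes; no; contradiction)
  open import Relation.Binary.PropositionalEquality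
  open FiniteSums
  open Matrices

  module _ {n : ℕ} where

    Symmetric : Matrix n → Set
    Symmetric S = ∀ u w → S u w ≡ S w u

    Loopless : Matrix n → Set
    Loopless S = ∀ u → S u u ≡ 0

    EvenMultigraph : Matrix n → Set
    EvenMultigraph S = Symmetric S × Loopless S × (∀ u → 2 ∣ rowSum S u)

    -- O orients S: each of the S u w parallel edges uw is directed u → w or w → u.
    Orientation : Matrix n → Matrix n → Set
    Orientation S O = ∀ u w → O u w + O w u ≡ S u w

    Balanced : Matrix n → Set
    Balanced O = ∀ u → rowSum O u ≡ colSum O u

    orientation-≐ : ∀ S T {O} → S ≐ T → Orientation S O → Orientation T O
    orientation-≐ S T S≐T orient u w = trans (orient u w) (S≐T u w)

    edge : Fin n → Fin n → Matrix n
    edge a b = unit a b ⊕ unit b a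

    edge-comm : ∀ a b → edge a b ≐ edge b a
    edge-comm a b u w = +-comm (unit a b u w) (unit b a u w)

    rowSum-edge : ∀ a b u → rowSum (edge a b) u ≡ δ u a + δ u b
    rowSum-edge a b u = trans (rowSum-⊕ (unit a b) (unit b a) u) (cong₂ _+_ (rowSum-unit a b u) (rowSum-unit b a u))

    total-edge : ∀ a b → total (edge a b) ≡ 2
    total-edge a b = trans (total-⊕ (unit a b) (unit b a)) (cong₂ _+_ (total-unit a b) (total-unit b a))

    edge-positive : ∀ a b → 0 < edge a b a b
    edge-positive a b = subst (λ m → 0 < m + unit b a a b) (sym (cong₂ _*_ (δ-refl a) (δ-refl b))) (s≤s z≤n)

    edge-≤ : ∀ (S : Matrix n) a b → Symmetric S → a ≢ b → 0 < S a b → ∀ u w → edge a b u w ≤ S u w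
    edge-≤ S a b sym-S a≢b 0<S u w with unit-cases a b u w | unit-cases b a u w
    ... | inj₁ (refl , refl , _) | inj₁ (a≡b , _ , _) = contradiction a≡b a≢b
    ... | inj₁ (refl , refl , e≡1) | inj₂ e′≡0 = subst (_≤ S a b) (sym (cong₂ _+_ e≡1 e′≡0)) 0<S
    ... | inj₂ e≡0 | inj₁ (refl , refl , e′≡1) =
      subst (_≤ S b a) (sym (cong₂ _+_ e≡0 e′≡1)) (subst (0 <_) (sym-S a b) 0<S)
    ... | inj₂ e≡0 | inj₂ e′≡0 = subst (_≤ S u w) (sym (cong₂ _+_ e≡0 e′≡0)) z≤n

    extend-by-path : ∀ {S₀ O₀} v a b → Orientation S₀ O₀
                   → (∀ u → rowSum O₀ u + δ u a ≡ colSum O₀ u + δ u b)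
                   → Orientation (S₀ ⊕ (edge v a ⊕ edge v b)) (O₀ ⊕ (unit a v ⊕ unit v b))
                   × Balanced (O₀ ⊕ (unit a v ⊕ unit v b))
    extend-by-path {S₀} {O₀} v a b orient imbalance = orient′ , balanced
      where
      orient′ : Orientation (S₀ ⊕ (edge v a ⊕ edge v b)) (O₀ ⊕ (unit a v ⊕ unit v b))
      orient′ u w
        rewrite unit-transpose a v w u | unit-transpose v b w u | sym (orient u w)
        = regroup (O₀ u w) (O₀ w u) (unit a v u w) (unit v b u w) (unit v a u w) (unit b v u w)
        where
        regroup : ∀ o o′ p q r s → o + (p + q) + (o′ + (r + s)) ≡ o + o′ + ((r + p) + (q + s))
        regroup = solve-∀
      balanced : Balanced (O₀ ⊕ (unit a v ⊕ unit v b))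
      balanced u = begin
        rowSum (O₀ ⊕ (unit a v ⊕ unit v b)) u         ≡⟨ rowSum-⊕ O₀ (unit a v ⊕ unit v b) u ⟩
        rowSum O₀ u + rowSum (unit a v ⊕ unit v b) u  ≡⟨ cong (rowSum O₀ u +_) (rowSum-⊕ (unit a v) (unit v b) u) ⟩
        rowSum O₀ u + (rowSum (unit a v) u + rowSum (unit v b) u)
          ≡⟨ cong (rowSum O₀ u +_) (cong₂ _+_ (rowSum-unit a v u) (rowSum-unit v b u)) ⟩
        rowSum O₀ u + (δ u a + δ u v)                 ≡⟨ shift (rowSum O₀ u) (colSum O₀ u) (δ u a) (δ u b) (δ u v) (imbalance u) ⟩
        colSum O₀ u + (δ u v + δ u b)
          ≡⟨ cong (colSum O₀ u +_) (cong₂ _+_ (colSum-unit a v u) (colSum-unit v b u)) ⟨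
        colSum O₀ u + (colSum (unit a v) u + colSum (unit v b) u)
          ≡⟨ cong (colSum O₀ u +_) (colSum-⊕ (unit a v) (unit v b) u) ⟨
        colSum O₀ u + colSum (unit a v ⊕ unit v b) u  ≡⟨ colSum-⊕ O₀ (unit a v ⊕ unit v b) u ⟨
        colSum (O₀ ⊕ (unit a v ⊕ unit v b)) u         ∎
        where
        open ≡-Reasoning
        shift : ∀ r c p q s → r + p ≡ c + q → r + (p + s) ≡ c + (s + q)
        shift r c p q s eq = begin
          r + (p + s)  ≡⟨ +-assoc r p s ⟨
          r + p + s    ≡⟨ cong (_+ s) eq ⟩
          c + q + s    ≡⟨ +-assoc c q s ⟩
          c + (q + s)  ≡⟨ cong (c +_) (+-comm q s) ⟩
          c + (s + q)  ∎

    remove-arc : ∀ {S₀ O} a b → Orientation (S₀ ⊕ edge a b) O → Balanced O → 0 < O a b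
               → Orientation S₀ (decrement O a b)
               × (∀ u → rowSum (decrement O a b) u + δ u a ≡ colSum (decrement O a b) u + δ u b)
    remove-arc {S₀} {O} a b orient balanced 0<O = orient′ , imbalance
      where
      O′ : Matrix n
      O′ = decrement O a b
      O≐ : O ≐ (O′ ⊕ unit a b)
      O≐ = decrement-⊕ O a b 0<O
      orient′ : Orientation S₀ O′
      orient′ u w = +-cancelʳ-≡ (unit a b u w + unit b a u w) _ _ (begin
        O′ u w + O′ w u + (unit a b u w + unit b a u w)
          ≡⟨ cong (λ t → O′ u w + O′ w u + (unit a b u w + t)) (unit-transpose b a u w) ⟩
        O′ u w + O′ w u + (unit a b u w + unit a b w u) ≡⟨ regroup (O′ u w) (O′ w u) (unit a b u w) (unit a b w u) ⟩
        (O′ u w + unit a b u w) + (O′ w u + unit a b w u) ≡⟨ cong₂ _+_ (O≐ u w) (O≐ w u) ⟨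
        O u w + O w u                                     ≡⟨ orient u w ⟩
        S₀ u w + (unit a b u w + unit b a u w)            ∎)
        where
        open ≡-Reasoning
        regroup : ∀ o o′ p q → o + o′ + (p + q) ≡ (o + p) + (o′ + q)
        regroup = solve-∀
      imbalance : ∀ u → rowSum O′ u + δ u a ≡ colSum O′ u + δ u b
      imbalance u = begin
        rowSum O′ u + δ u a                ≡⟨ cong (rowSum O′ u +_) (rowSum-unit a b u) ⟨
        rowSum O′ u + rowSum (unit a b) u  ≡⟨ rowSum-⊕ O′ (unit a b) u ⟨
        rowSum (O′ ⊕ unit a b) u           ≡⟨ rowSum-≐ O≐ u ⟨
        rowSum O u                         ≡⟨ balanced u ⟩
        colSum O u                         ≡⟨ colSum-≐ O≐ u ⟩
        colSum (O′ ⊕ unit a b) u           ≡⟨ colSum-⊕ O′ (unit a b) u ⟩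
        colSum O′ u + colSum (unit a b) u  ≡⟨ cong (colSum O′ u +_) (colSum-unit a b u) ⟩
        colSum O′ u + δ u b                ∎
        where open ≡-Reasoning

    edge-symmetric : ∀ a b → Symmetric (edge a b)
    edge-symmetric a b u w = begin
      unit a b u w + unit b a u w  ≡⟨ cong₂ _+_ (unit-transpose a b u w) (unit-transpose b a u w) ⟩
      unit b a w u + unit a b w u  ≡⟨ +-comm (unit b a w u) (unit a b w u) ⟩
      unit a b w u + unit b a w u  ∎
      where open ≡-Reasoning

    edge-loopless : ∀ {a b} → a ≢ b → Loopless (edge a b)
    edge-loopless {a} {b} a≢b u with unit-cases a b u u | unit-cases b a u u
    ... | inj₁ (refl , refl , _) | _                      = contradiction refl a≢b
    ... | inj₂ _                 | inj₁ (refl , refl , _) = contradiction refl a≢b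
    ... | inj₂ e≡0               | inj₂ e′≡0              = cong₂ _+_ e≡0 e′≡0

    removeEdge : Matrix n → Fin n → Fin n → Matrix n
    removeEdge S a b = S ⊖ edge a b

    module RemoveEdge {S : Matrix n} (sym-S : Symmetric S) (loopless : Loopless S) where

      distinct : ∀ {a b} → 0 < S a b → a ≢ b
      distinct {a} 0<S refl = <-irrefl (sym (loopless a)) 0<S

      removeEdge-⊕ : ∀ {a b} → 0 < S a b → S ≐ (removeEdge S a b ⊕ edge a b)
      removeEdge-⊕ {a} {b} 0<S = ⊖-⊕ S (edge a b) (edge-≤ S a b sym-S (distinct 0<S) 0<S)

      removeEdge-symmetric : ∀ a b → Symmetric (removeEdge S a b)
      removeEdge-symmetric a b u w = cong₂ _∸_ (sym-S u w) (edge-symmetric a b u w)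

      removeEdge-loopless : ∀ a b → Loopless (removeEdge S a b)
      removeEdge-loopless a b u = trans (cong (_∸ edge a b u u) (loopless u)) (0∸n≡0 (edge a b u u))

      removeEdge-rowSum : ∀ {a b} → 0 < S a b → ∀ u → rowSum S u ≡ rowSum (removeEdge S a b) u + (δ u a + δ u b)
      removeEdge-rowSum {a} {b} 0<S u =
        trans (rowSum-≐ (removeEdge-⊕ 0<S) u)
              (trans (rowSum-⊕ (removeEdge S a b) (edge a b) u) (cong (rowSum (removeEdge S a b) u +_) (rowSum-edge a b u)))

      removeEdge-total : ∀ {a b} → 0 < S a b → total S ≡ total (removeEdge S a b) + 2
      removeEdge-total {a} {b} 0<S =
        trans (total-≐ (removeEdge-⊕ 0<S))
              (trans (total-⊕ (removeEdge S a b) (edge a b)) (cong (total (removeEdge S a b) +_) (total-edge a b)))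

    odd⇒positive : ∀ m → 2 ∣ m + 1 → 0 < m
    odd⇒positive zero    2∣1 = contradiction (∣1⇒≡1 2∣1) λ ()
    odd⇒positive (suc m) _   = s≤s z≤n

    even-cancel : ∀ m t → 2 ∣ m + (t + t) → 2 ∣ m
    even-cancel m t 2∣ = ∣m+n∣m⇒∣n (subst (2 ∣_) (+-comm m (t + t)) 2∣) (divides t t+t≡t*2)
      where
      t+t≡t*2 : t + t ≡ t * 2
      t+t≡t*2 = trans (cong (t +_) (sym (+-identityʳ t))) (*-comm 2 t)

    second-neighbour : ∀ {S} → EvenMultigraph S → ∀ {v a} → 0 < S v a → ∃ λ b → 0 < removeEdge S v a v b
    second-neighbour {S} (sym-S , loopless , even) {v} {a} 0<Sva =
      ∑-positive (removeEdge S v a v) (odd⇒positive _ (subst (2 ∣_) degree-v (even v)))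
      where
      open RemoveEdge sym-S loopless
      degree-v : rowSum S v ≡ rowSum (removeEdge S v a) v + 1
      degree-v = trans (removeEdge-rowSum 0<Sva v)
                       (cong (rowSum (removeEdge S v a) v +_) (cong₂ _+_ (δ-refl v) (δ-≢ (distinct 0<Sva))))

    -- If a = b the doubled edge va is
    -- deleted; otherwise the path a v b is replaced by the edge ab.  Either way
    -- the total shrinks, and a balanced orientation of the result lifts back.
    module SplitOff {S : Matrix n} (G : EvenMultigraph S) {v a b : Fin n}
                    (0<Sva : 0 < S v a) (0<S₁vb : 0 < removeEdge S v a v b) where

      private
        sym-S : Symmetric S
        sym-S = proj₁ G
        loopless : Loopless S
        loopless = proj₁ (proj₂ G)
        even : ∀ u → 2 ∣ rowSum S u
        even = proj₂ (proj₂ G)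
        module R = RemoveEdge sym-S loopless
        module R₁ = RemoveEdge (R.removeEdge-symmetric v a) (R.removeEdge-loopless v a)

      S₂ : Matrix n
      S₂ = removeEdge (removeEdge S v a) v b

      regroup : ∀ x p q → x + q + p ≡ x + (p + q)
      regroup x p q = trans (+-assoc x q p) (cong (x +_) (+-comm q p))

      decomposition : (S₂ ⊕ (edge v a ⊕ edge v b)) ≐ S
      decomposition u w = sym (begin
        S u w                                         ≡⟨ R.removeEdge-⊕ 0<Sva u w ⟩
        removeEdge S v a u w + edge v a u w           ≡⟨ cong (_+ edge v a u w) (R₁.removeEdge-⊕ 0<S₁vb u w) ⟩
        S₂ u w + edge v b u w + edge v a u w          ≡⟨ regroup (S₂ u w) (edge v a u w) (edge v b u w) ⟩
        S₂ u w + (edge v a u w + edge v b u w)        ∎)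
        where open ≡-Reasoning

      rowSum-S : ∀ u → rowSum S u ≡ rowSum S₂ u + ((δ u v + δ u a) + (δ u v + δ u b))
      rowSum-S u = trans (R.removeEdge-rowSum 0<Sva u)
                     (trans (cong (_+ (δ u v + δ u a)) (R₁.removeEdge-rowSum 0<S₁vb u))
                       (regroup (rowSum S₂ u) (δ u v + δ u a) (δ u v + δ u b)))

      total-S : total S ≡ total S₂ + 4
      total-S = trans (R.removeEdge-total 0<Sva)
                  (trans (cong (_+ 2) (R₁.removeEdge-total 0<S₁vb)) (+-assoc (total S₂) 2 2))

      double-edge-even : a ≡ b → EvenMultigraph S₂
      double-edge-even refl = R₁.removeEdge-symmetric v b , R₁.removeEdge-loopless v b ,
        λ u → even-cancel (rowSum S₂ u) (δ u v + δ u a) (subst (2 ∣_) (rowSum-S u) (even u))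

      double-edge-smaller : total S₂ < total S
      double-edge-smaller = subst (total S₂ <_) (sym total-S) (m<m+n (total S₂) (s≤s z≤n))

      lift-double-edge : a ≡ b → ∃ (λ O₂ → Orientation S₂ O₂ × Balanced O₂) → ∃ λ O → Orientation S O × Balanced O
      lift-double-edge a≡b (O₂ , orient , balanced) =
        let O = O₂ ⊕ (unit a v ⊕ unit v b)
            orient′ , balanced′ = extend-by-path {S₂} {O₂} v a b orient (λ u → cong₂ _+_ (balanced u) (cong (δ u) a≡b))
        in O , orientation-≐ (S₂ ⊕ (edge v a ⊕ edge v b)) S {O} decomposition orient′ , balanced′

      S′ : Matrix n
      S′ = S₂ ⊕ edge a b

      path-even : a ≢ b → EvenMultigraph S′
      path-even a≢b = symmetric , loopless′ , even′
        where
        symmetric : Symmetric S′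
        symmetric u w = cong₂ _+_ (R₁.removeEdge-symmetric v b u w) (edge-symmetric a b u w)
        loopless′ : Loopless S′
        loopless′ u = cong₂ _+_ (R₁.removeEdge-loopless v b u) (edge-loopless a≢b u)
        even′ : ∀ u → 2 ∣ rowSum S′ u
        even′ u = even-cancel (rowSum S′ u) (δ u v) (subst (2 ∣_) degree (even u))
          where
          shuffle : ∀ r x y z → r + ((x + y) + (x + z)) ≡ r + (y + z) + (x + x)
          shuffle = solve-∀
          degree : rowSum S u ≡ rowSum S′ u + (δ u v + δ u v)
          degree = trans (rowSum-S u) (trans (shuffle (rowSum S₂ u) (δ u v) (δ u a) (δ u b))
                     (cong (_+ (δ u v + δ u v)) (sym (trans (rowSum-⊕ S₂ (edge a b) u)
                       (cong (rowSum S₂ u +_) (rowSum-edge a b u))))))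

      path-smaller : total S′ < total S
      path-smaller = subst₂ _<_ (sym (trans (total-⊕ S₂ (edge a b)) (cong (total S₂ +_) (total-edge a b))))
                                (sym total-S) (+-monoʳ-< (total S₂) (s≤s (s≤s (s≤s z≤n))))

      reroute : ∀ c d → (S₂ ⊕ (edge v c ⊕ edge v d)) ≐ S
              → ∀ {O′} → Orientation (S₂ ⊕ edge c d) O′ → Balanced O′ → 0 < O′ c d
              → ∃ λ O → Orientation S O × Balanced O
      reroute c d decomposition′ {O′} orient balanced 0<O′ =
        let O₀ = decrement O′ c d
            O = O₀ ⊕ (unit c v ⊕ unit v d)
            orient₀ , imbalance = remove-arc {S₂} {O′} c d orient balanced 0<O′
            orient₁ , balanced₁ = extend-by-path {S₂} {O₀} v c d orient₀ imbalance
        in O , orientation-≐ (S₂ ⊕ (edge v c ⊕ edge v d)) S {O} decomposition′ orient₁ , balanced₁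

      lift-path : ∃ (λ O′ → Orientation S′ O′ × Balanced O′) → ∃ λ O → Orientation S O × Balanced O
      lift-path (O′ , orient , balanced) with O′ a b in O′ab
      ... | suc _ = reroute a b decomposition {O′} orient balanced (subst (0 <_) (sym O′ab) (s≤s z≤n))
      ... | zero  = reroute b a decomposition-ba {O′} (orientation-≐ S′ (S₂ ⊕ edge b a) {O′} (λ u w → cong (S₂ u w +_) (edge-comm a b u w)) orient)
                      balanced 0<O′ba
        where
        decomposition-ba : (S₂ ⊕ (edge v b ⊕ edge v a)) ≐ S
        decomposition-ba u w = trans (cong (S₂ u w +_) (+-comm (edge v b u w) (edge v a u w))) (decomposition u w)
        0<O′ba : 0 < O′ b a
        0<O′ba = subst (0 <_) (trans (sym (orient a b)) (cong (_+ O′ b a) O′ab))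
                   (≤-trans (edge-positive a b) (m≤n+m (edge a b a b) (S₂ a b)))

    euler-orientation : ∀ S → EvenMultigraph S → ∃ λ O → Orientation S O × Balanced O
    euler-orientation S = <-rec P induct (total S) S refl
      where
      P : ℕ → Set
      P T = ∀ S → total S ≡ T → EvenMultigraph S → ∃ λ O → Orientation S O × Balanced O
      induct : ∀ T → (∀ {T′} → T′ < T → P T′) → P T
      induct _ recurse S refl G with total S ℕ≟ 0
      ... | yes empty = (λ _ _ → 0) , (λ u w → sym (total≡0 S empty u w)) , (λ _ → refl)
      ... | no  nonempty with positive-entry S (n≢0⇒n>0 nonempty)
      ...   | v , a , 0<Sva with second-neighbour G 0<Sva
      ...     | b , 0<S₁vb with a ≟ b
      ...       | yes a≡b = lift-double-edge a≡b (recurse double-edge-smaller S₂ refl (double-edge-even a≡b))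
        where open SplitOff G 0<Sva 0<S₁vb
      ...       | no  a≢b = lift-path (recurse path-smaller S′ refl (path-even a≢b))
        where open SplitOff G 0<Sva 0<S₁vb

module ListsAndSubsets where

  open import Data.Bool using (Bool; true; false)
  open import Data.Nat using (ℕ; zero; suc; _+_; _≤_; z≤n; s≤s)
  import Data.Nat.Properties
  open import Data.Nat.Combinatorics using (_C_; nCk+nC[k+1]≡[n+1]C[k+1])
  open import Data.Nat.ListAction using () renaming (sum to listSum)
  open import Data.Fin using (Fin; zero; suc)
  open import Data.List using (List; []; _∷_; _++_; map; concatMap; length) renaming (tabulate to listTabulate)
  open import Data.List.Properties using (length-map; length-++; length-removeAt′)
  open import Data.List.Membership.Propositional using (_∈_)
  open import Data.List.Membership.Propositional.Properties using (∈-map⁺; ∈-++⁺ˡ; ∈-++⁺ʳ)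
  open import Data.List.Relation.Unary.Any using (here; there; index; _─_)
  import Data.List.Relation.Unary.All as All
  open import Data.List.Relation.Unary.AllPairs using (_∷_)
  open import Data.List.Relation.Unary.Unique.Propositional using (Unique)
  open import Data.Vec using (Vec; []; _∷_; tabulate)
  open import Function using (_∘_)
  open import Relation.Nullary using (contradiction)
  open import Relation.Binary.PropositionalEquality
  open import Algebra.Properties.Semiring.Sum Data.Nat.Properties.+-*-semiring using (sum-syntax)
  open FiniteSums

  ∈-─ : ∀ {A : Set} {x z : A} (ys : List A) (x∈ys : x ∈ ys) → z ∈ ys → z ≢ x → z ∈ (ys ─ x∈ys)
  ∈-─ (y ∷ ys) (here refl)  (here refl) z≢x = contradiction refl z≢x
  ∈-─ (y ∷ ys) (here _)     (there z∈)  _   = z∈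
  ∈-─ (y ∷ ys) (there x∈ys) (here refl) _   = here refl
  ∈-─ (y ∷ ys) (there x∈ys) (there z∈)  z≢x = there (∈-─ ys x∈ys z∈ z≢x)

  unique-length-≤ : ∀ {A : Set} (xs ys : List A) → Unique xs → (∀ {x} → x ∈ xs → x ∈ ys) → length xs ≤ length ys
  unique-length-≤ []       ys _             _    = z≤n
  unique-length-≤ (x ∷ xs) ys (x∉xs ∷ uniq) xs⊆ys =
    subst (suc (length xs) ≤_) (sym (length-removeAt′ ys (index x∈ys)))
      (s≤s (unique-length-≤ xs (ys ─ x∈ys) uniq
              (λ z∈xs → ∈-─ ys x∈ys (xs⊆ys (there z∈xs)) (λ z≡x → All.lookup x∉xs z∈xs (sym z≡x)))))
    where
    x∈ys : x ∈ ys
    x∈ys = xs⊆ys (here refl)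

  length-concatMap : ∀ {A B : Set} (f : A → List B) xs → length (concatMap f xs) ≡ listSum (map (length ∘ f) xs)
  length-concatMap f []       = refl
  length-concatMap f (x ∷ xs) = trans (length-++ (f x)) (cong (length (f x) +_) (length-concatMap f xs))

  size : ∀ {k} → Vec Bool k → ℕ
  size []      = 0
  size (b ∷ s) = 𝟙 b + size s

  size-tabulate : ∀ {k} (p : Fin k → Bool) → size (tabulate p) ≡ count p
  size-tabulate {zero}  p = refl
  size-tabulate {suc k} p = cong (𝟙 (p zero) +_) (size-tabulate (p ∘ suc))

  subsetsOfSize : (k j : ℕ) → List (Vec Bool k)
  subsetsOfSize zero    zero    = [] ∷ []
  subsetsOfSize zero    (suc j) = []
  subsetsOfSize (suc k) zero    = map (false ∷_) (subsetsOfSize k zero)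
  subsetsOfSize (suc k) (suc j) = map (true ∷_) (subsetsOfSize k j) ++ map (false ∷_) (subsetsOfSize k (suc j))

  length-subsetsOfSize : ∀ k j → length (subsetsOfSize k j) ≡ k C j
  length-subsetsOfSize zero    zero    = refl
  length-subsetsOfSize zero    (suc j) = refl
  length-subsetsOfSize (suc k) zero    = trans (length-map _ (subsetsOfSize k zero)) (length-subsetsOfSize k zero)
  length-subsetsOfSize (suc k) (suc j) = begin
    length (map (true ∷_) (subsetsOfSize k j) ++ map (false ∷_) (subsetsOfSize k (suc j)))
      ≡⟨ length-++ (map (true ∷_) (subsetsOfSize k j)) ⟩
    length (map (true ∷_) (subsetsOfSize k j)) + length (map (false ∷_) (subsetsOfSize k (suc j)))
      ≡⟨ cong₂ _+_ (length-map _ (subsetsOfSize k j)) (length-map _ (subsetsOfSize k (suc j))) ⟩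
    length (subsetsOfSize k j) + length (subsetsOfSize k (suc j))
      ≡⟨ cong₂ _+_ (length-subsetsOfSize k j) (length-subsetsOfSize k (suc j)) ⟩
    k C j + k C suc j
      ≡⟨ nCk+nC[k+1]≡[n+1]C[k+1] k j ⟩
    suc k C suc j ∎
    where open ≡-Reasoning

  ∈-subsetsOfSize : ∀ {k} (s : Vec Bool k) → s ∈ subsetsOfSize k (size s)
  ∈-subsetsOfSize []          = here refl
  ∈-subsetsOfSize (true ∷ s)  = ∈-++⁺ˡ (∈-map⁺ (true ∷_) (∈-subsetsOfSize s))
  ∈-subsetsOfSize {suc k} (false ∷ s) with size s | ∈-subsetsOfSize s
  ... | zero  | s∈ = ∈-map⁺ (false ∷_) s∈
  ... | suc j | s∈ = ∈-++⁺ʳ (map (true ∷_) (subsetsOfSize k j)) (∈-map⁺ (false ∷_) s∈)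

  listSum-tabulate : ∀ {n} {B : Set} (g : Fin n → B) (f : B → ℕ) → listSum (map f (listTabulate g)) ≡ ∑[ i < n ] f (g i)
  listSum-tabulate {zero}  g f = refl
  listSum-tabulate {suc n} g f = cong (f (g zero) +_) (listSum-tabulate (g ∘ suc) f)

module PaletteConstruction where

  open import Data.Bool using (Bool; true; false; if_then_else_; not; _∧_; T)
  open import Data.Bool.Properties using (T-≡; T-∧; ¬-not; not-involutive) renaming (_≟_ to _≟ᵇ_)
  open import Data.Bool.ListAction using (any)
  open import Data.Empty using (⊥)
  open import Data.Nat using (ℕ; zero; suc; _+_; _*_; _∸_; _≤_; _<_; _⊔_; z≤n; s≤s; ⌊_/2⌋)
  open import Data.Nat.Properties hiding (_≟_)
  import Data.Nat.Properties as ℕₚ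
  open import Data.Nat.Divisibility using (_∣_; divides)
  open import Data.Nat.ListAction using () renaming (sum to listSum)
  open import Data.Fin using (Fin; fromℕ<; join; splitAt)
  open import Data.Fin.Properties using (_≟_; splitAt-join; join-splitAt)
  open import Data.List using (List; _∷_; foldr; map; allFin; concatMap; length; deduplicate)
  open import Data.List.Properties using (length-map; map-cong)
  open import Data.List.Membership.Propositional using (_∈_)
  open import Data.List.Membership.Propositional.Properties
    using (∈-map⁺; ∈-map⁻; ∈-allFin; ∈-concatMap⁺; ∈-deduplicate⁺; ∈-deduplicate⁻)
  open import Data.List.Relation.Unary.Any using (here; there; satisfied)
  import Data.List.Relation.Unary.Any as Any
  open import Data.List.Relation.Unary.Any.Properties using (any⁺; any⁻)
  open import Data.List.Relation.Unary.Unique.DecPropositional.Properties using (deduplicate-!)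
  open import Data.Vec using (Vec)
  import Data.Vec as Vec
  import Data.Vec.Properties as VecP
  open import Data.Product using (∃; _×_; _,_; proj₁; proj₂)
  open import Data.Sum using (_⊎_; inj₁; inj₂)
  open import Function using (_∘_; id; Equivalence)
  open import Relation.Nullary using (yes; no; contradiction)
  open import Relation.Nullary.Decidable using (⌊_⌋; toWitness; fromWitness)
  open import Relation.Binary.PropositionalEquality
  open import Algebra.Properties.Semiring.Sum +-*-semiring using (sum-syntax; sum-cong-≗; ∑-distrib-+)
  open import Defs hiding (sym)
  open FiniteSums
  open Matrices
  open EulerOrientation
  open KonigColouring
  open ListsAndSubsets

  if-𝟙 : ∀ b → (if b then 1 else 0) ≡ 𝟙 b
  if-𝟙 true  = refl
  if-𝟙 false = refl

  half-double : ∀ m → ⌊ (m + m) /2⌋ ≡ m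
  half-double zero    = refl
  half-double (suc m) = trans (cong (λ t → ⌊ suc t /2⌋) (+-suc m m)) (cong suc (half-double m))

  ≤-foldr-⊔ : ∀ {x} xs → x ∈ xs → x ≤ foldr _⊔_ 0 xs
  ≤-foldr-⊔ (y ∷ ys) (here refl) = m≤m⊔n y _
  ≤-foldr-⊔ (y ∷ ys) (there x∈) = ≤-trans (≤-foldr-⊔ ys x∈) (m≤n⊔m y _)

  even-positive⇒≥2 : ∀ m → 1 ≤ m → 2 ∣ m → 2 ≤ m
  even-positive⇒≥2 (suc zero)    _ (divides (suc q) ())
  even-positive⇒≥2 (suc (suc m)) _ _ = s≤s (s≤s z≤n)

  module Occurrence {n m : ℕ} (G : Graph n) (c : EdgeColouring G m) where

    occurs : Fin n → Fin m → Bool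
    occurs v κ = any (λ u → adj G v u ∧ ⌊ c v u ≟ κ ⌋) (allFin n)

    occurs-sound : ∀ {v κ} → occurs v κ ≡ true → ∃ λ u → adj G v u ≡ true × c v u ≡ κ
    occurs-sound {v} {κ} occ with satisfied (any⁻ _ (allFin n) (Equivalence.from T-≡ occ))
    ... | u , edge-with-κ = u , Equivalence.to T-≡ (proj₁ both) , toWitness (proj₂ both)
      where
      both : T (adj G v u) × T ⌊ c v u ≟ κ ⌋
      both = Equivalence.to T-∧ edge-with-κ

    occurs-complete : ∀ {v u κ} → adj G v u ≡ true → c v u ≡ κ → occurs v κ ≡ true
    occurs-complete {v} {u} {κ} vu cvu≡κ = Equivalence.to T-≡ (any⁺ _ (Any.map witness (∈-allFin u)))
      where
      witness : ∀ {w} → u ≡ w → T (adj G v w ∧ ⌊ c v w ≟ κ ⌋)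
      witness refl = Equivalence.from T-∧ (Equivalence.from T-≡ vu , fromWitness cvu≡κ)

  module Construction {n : ℕ} (G : Graph n) (side : Fin n → Bool)
                      (bipartite : ∀ u v → adj G u v ≡ true → side u ≢ side v)
                      (no-isolated : NoIsolatedVertices G) (even-degrees : AllDegreesEven G) where

    A : Matrix n
    A u w = 𝟙 (adj G u w)

    degree≡rowSum : ∀ v → degree G v ≡ rowSum A v
    degree≡rowSum v = trans (listSum-tabulate id (λ u → if adj G v u then 1 else 0)) (sum-cong-≗ (λ u → if-𝟙 (adj G v u)))

    A-even : EvenMultigraph A
    A-even = (λ u w → cong 𝟙 (Graph.sym G u w)) , (λ u → cong 𝟙 (irrefl G u)) ,
             (λ u → subst (2 ∣_) (degree≡rowSum u) (even-degrees u))

    half : Fin n → ℕ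
    half v = ⌊ degree G v /2⌋

    k : ℕ
    k = ⌊ maxDegree G /2⌋

    half≤k : ∀ v → half v ≤ k
    half≤k v = ⌊n/2⌋-mono (≤-foldr-⊔ _ (∈-map⁺ (degree G) (∈-allFin v)))

    k>0 : Fin n → 0 < k
    k>0 v = ≤-trans (⌊n/2⌋-mono (even-positive⇒≥2 _ (no-isolated v) (even-degrees v))) (half≤k v)

    module Oriented (O : Matrix n) (O-orients : Orientation A O) (O-balanced : Balanced O) where

      outdegree : ∀ v → rowSum O v ≡ half v
      outdegree v = sym (trans (cong ⌊_/2⌋ degree≡2out) (half-double (rowSum O v)))
        where
        degree≡2out : degree G v ≡ rowSum O v + rowSum O v
        degree≡2out = begin
          degree G v                   ≡⟨ degree≡rowSum v ⟩
          ∑[ w < n ] A v w             ≡⟨ sum-cong-≗ (O-orients v) ⟨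
          ∑[ w < n ] (O v w + O w v)   ≡⟨ ∑-distrib-+ (O v) (λ w → O w v) ⟩
          rowSum O v + colSum O v      ≡⟨ cong (rowSum O v +_) (O-balanced v) ⟨
          rowSum O v + rowSum O v      ∎
          where open ≡-Reasoning

      arc-cases : ∀ u w → adj G u w ≡ true → (O u w ≡ 1 × O w u ≡ 0) ⊎ (O u w ≡ 0 × O w u ≡ 1)
      arc-cases u w uw with O u w | O w u | trans (O-orients u w) (cong 𝟙 uw)
      ... | 0 | 1 | _ = inj₂ (refl , refl)
      ... | 1 | 0 | _ = inj₁ (refl , refl)
      ... | 0 | suc (suc _) | ()
      ... | suc (suc _) | _ | ()
      ... | 1 | suc _ | ()

      O≤A : ∀ u w → O u w ≤ A u w
      O≤A u w = subst (O u w ≤_) (O-orients u w) (m≤m+n (O u w) (O w u))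

      O≤1 : ∀ u w → O u w ≤ 1
      O≤1 u w = ≤-trans (O≤A u w) (𝟙≤1 (adj G u w))

      arc⇒adj : ∀ {u w} → 0 < O u w → adj G u w ≡ true
      arc⇒adj {u} {w} 0<O = 𝟙>0⇒true (≤-trans 0<O (O≤A u w))

      arc⇒no-reverse : ∀ {u w} → 0 < O u w → O w u ≡ 0
      arc⇒no-reverse {u} {w} 0<O with arc-cases u w (arc⇒adj 0<O)
      ... | inj₁ (_ , O-wu≡0) = O-wu≡0
      ... | inj₂ (O-uw≡0 , _) = contradiction (subst (0 <_) O-uw≡0 0<O) λ ()

      O-loopless : ∀ v → O v v ≡ 0
      O-loopless v = n≤0⇒n≡0 (subst (O v v ≤_) (cong 𝟙 (irrefl G v)) (O≤A v v))

      -- Padding O with k ∸ half v loops at v gives a k-regular bipartite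
      -- multigraph between tails (rows) and heads (columns).
      pad : Fin n → ℕ
      pad v = k ∸ half v

      M : Matrix n
      M = O ⊕ (λ u w → δ u w * pad u)

      rowSum-M : ∀ u → rowSum M u ≡ k
      rowSum-M u = begin
        rowSum M u                                ≡⟨ rowSum-⊕ O (λ u w → δ u w * pad u) u ⟩
        rowSum O u + ∑[ w < n ] (δ u w * pad u)   ≡⟨ cong₂ _+_ (outdegree u) (sum-cong-≗ (λ w → cong (_* pad u) (δ-sym u w))) ⟩
        half u + ∑[ w < n ] (δ w u * pad u)       ≡⟨ cong (half u +_) (∑-δ-select u (λ _ → pad u)) ⟩
        half u + pad u                            ≡⟨ m+[n∸m]≡n (half≤k u) ⟩
        k                                         ∎
        where open ≡-Reasoning

      colSum-M : ∀ w → colSum M w ≡ k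
      colSum-M w = begin
        colSum M w                                ≡⟨ colSum-⊕ O (λ u w → δ u w * pad u) w ⟩
        colSum O w + ∑[ u < n ] (δ u w * pad u)   ≡⟨ cong₂ _+_ (trans (sym (O-balanced w)) (outdegree w)) (∑-δ-select w pad) ⟩
        half w + pad w                            ≡⟨ m+[n∸m]≡n (half≤k w) ⟩
        k                                         ∎
        where open ≡-Reasoning

      M-off-diagonal : ∀ {u w} → u ≢ w → M u w ≡ O u w
      M-off-diagonal {u} {w} u≢w = trans (cong (λ d → O u w + d * pad u) (δ-≢ u≢w)) (+-identityʳ (O u w))

      M-diagonal : ∀ v → M v v ≡ pad v
      M-diagonal v = cong₂ _+_ (O-loopless v) (trans (cong (_* pad v) (δ-refl v)) (+-identityʳ (pad v)))

      open MatrixColouring k n public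

      module Decomposed (π : Colouring) (π-matchings : Matchings π) (π-counts : ∀ r c → multiplicity π r c ≡ M r c) where

        -- The matching class containing the arc t → h (an arbitrary class when there is no arc).
        classOf : Fin n → Fin n → Fin k
        classOf t h with search (λ i → π i t h)
        ... | inj₁ (i , _) = i
        ... | inj₂ _       = fromℕ< (k>0 t)

        classOf-spec : ∀ {t h} → 0 < O t h → π (classOf t h) t h ≡ true
        classOf-spec {t} {h} 0<O with search (λ i → π i t h)
        ... | inj₁ (_ , in-class) = in-class
        ... | inj₂ none with ∑-positive (λ i → 𝟙 (π i t h)) 0<multiplicity
          where
          0<multiplicity : 0 < multiplicity π t h
          0<multiplicity = subst (0 <_) (sym (π-counts t h)) (≤-trans 0<O (m≤m+n (O t h) _))
        ...   | i , 0<𝟙 = contradiction (trans (sym (𝟙>0⇒true 0<𝟙)) (none i)) true≢false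

        multiplicity-off-diagonal : ∀ {t h} → t ≢ h → multiplicity π t h ≡ O t h
        multiplicity-off-diagonal t≢h = trans (π-counts _ _) (M-off-diagonal t≢h)

        class⇒arc : ∀ {i t h} → t ≢ h → π i t h ≡ true → O t h ≡ 1
        class⇒arc {i} {t} {h} t≢h in-class = ≤-antisym (O≤1 t h)
          (subst (1 ≤_) (multiplicity-off-diagonal t≢h)
            (subst (_≤ multiplicity π t h) (cong 𝟙 in-class) (term≤∑ (λ j → 𝟙 (π j t h)) i)))

        classOf-unique : ∀ {i t h} → t ≢ h → π i t h ≡ true → classOf t h ≡ i
        classOf-unique {i} {t} {h} t≢h in-class =
          count≤1⇒atMostOne (λ j → π j t h) (subst (_≤ 1) (sym (multiplicity-off-diagonal t≢h)) (O≤1 t h))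
            (classOf t h) i (classOf-spec (subst (0 <_) (sym (class⇒arc t≢h in-class)) (s≤s z≤n))) in-class

        -- Colours are pairs (class, side of the tail), encoded in Fin (k + k).
        tagged : Fin k → Bool → Fin k ⊎ Fin k
        tagged i false = inj₁ i
        tagged i true  = inj₂ i

        paint : Fin k → Bool → Fin (k + k)
        paint i s = join k k (tagged i s)

        paint-injective : ∀ {i j s t} → paint i s ≡ paint j t → i ≡ j × s ≡ t
        paint-injective {i} {j} {s} {t} eq = untag (trans (sym (splitAt-join k k (tagged i s)))
                                                     (trans (cong (splitAt k) eq) (splitAt-join k k (tagged j t))))
          where
          untag : ∀ {i j s t} → tagged i s ≡ tagged j t → i ≡ j × s ≡ t
          untag {s = false} {false} refl = refl , refl
          untag {s = true}  {true}  refl = refl , refl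
          untag {s = false} {true}  ()
          untag {s = true}  {false} ()

        colour : EdgeColouring G (k + k)
        colour u w with O u w
        ... | zero  = paint (classOf w u) (side w)
        ... | suc _ = paint (classOf u w) (side u)

        colour-out : ∀ {u w} → O u w ≡ 1 → colour u w ≡ paint (classOf u w) (side u)
        colour-out uw rewrite uw = refl

        colour-in : ∀ {u w} → O u w ≡ 0 → colour u w ≡ paint (classOf w u) (side w)
        colour-in uw rewrite uw = refl

        out-arc-class : ∀ {u w} → O u w ≡ 1 → π (classOf u w) u w ≡ true
        out-arc-class uw = classOf-spec (subst (0 <_) (sym uw) (s≤s z≤n))

        colour-symmetric : ∀ u w → adj G u w ≡ true → colour u w ≡ colour w u
        colour-symmetric u w uw with arc-cases u w uw
        ... | inj₁ (out , back) = trans (colour-out out) (sym (colour-in back))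
        ... | inj₂ (back , out) = trans (colour-in back) (sym (colour-out out))

        colour-proper : ∀ v u w → adj G v u ≡ true → adj G v w ≡ true → colour v u ≡ colour v w → u ≡ w
        colour-proper v u w vu vw same with arc-cases v u vu | arc-cases v w vw
        ... | inj₁ (vu-out , _) | inj₁ (vw-out , _) =
          proj₁ (π-matchings (classOf v u)) v u w (out-arc-class vu-out)
            (subst (λ i → π i v w ≡ true) (sym (proj₁ classes)) (out-arc-class vw-out))
          where
          classes : classOf v u ≡ classOf v w × side v ≡ side v
          classes = paint-injective (trans (sym (colour-out vu-out)) (trans same (colour-out vw-out)))
        ... | inj₂ (vu-in , uv-out) | inj₂ (vw-in , wv-out) =
          proj₂ (π-matchings (classOf u v)) v u w (out-arc-class uv-out)
            (subst (λ i → π i w v ≡ true) (sym (proj₁ classes)) (out-arc-class wv-out))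
          where
          classes : classOf u v ≡ classOf w v × side u ≡ side w
          classes = paint-injective (trans (sym (colour-in vu-in)) (trans same (colour-in vw-in)))
        ... | inj₁ (vu-out , _) | inj₂ (vw-in , _) =
          contradiction (proj₂ (paint-injective {classOf v u} {classOf w v} {side v} {side w}
                                   (trans (sym (colour-out vu-out)) (trans same (colour-in vw-in))))) (bipartite v w vw)
        ... | inj₂ (vu-in , _) | inj₁ (vw-out , _) =
          contradiction (sym (proj₂ (paint-injective {classOf u v} {classOf v w} {side u} {side v}
                                        (trans (sym (colour-in vu-in)) (trans same (colour-out vw-out)))))) (bipartite v u vu)

        -- The palette of v: colour (i, s) occurs at v iff class i avoids the loop at v,
        -- since a class through v either is the loop or enters and leaves v.
        open Occurrence G colour

        rowSum-multiplicity : ∀ v → rowSum (multiplicity π) v ≡ k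
        rowSum-multiplicity v = trans (sum-cong-≗ (π-counts v)) (rowSum-M v)

        colSum-multiplicity : ∀ v → colSum (multiplicity π) v ≡ k
        colSum-multiplicity v = trans (sum-cong-≗ (λ u → π-counts u v)) (colSum-M v)

        no-loop-edge : ∀ {v u} → v ≡ u → adj G v u ≡ true → ⊥
        no-loop-edge {v} refl vu = true≢false (trans (sym vu) (irrefl G v))

        occurs⇒no-loop : ∀ {v i s} → occurs v (paint i s) ≡ true → π i v v ≡ false
        occurs⇒no-loop {v} {i} {s} occ with occurs-sound occ
        ... | u , vu , coloured = ¬-not λ loop → no-loop-edge (v≡u loop) vu
          where
          v≡u : π i v v ≡ true → v ≡ u
          v≡u loop with arc-cases v u vu
          ... | inj₁ (vu-out , _) = proj₁ (π-matchings i) v v u loop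
                 (subst (λ j → π j v u ≡ true) (proj₁ (paint-injective {classOf v u} {i} {side v} {s}
                   (trans (sym (colour-out vu-out)) coloured))) (out-arc-class vu-out))
          ... | inj₂ (vu-in , uv-out) = proj₂ (π-matchings i) v v u loop
                 (subst (λ j → π j u v ≡ true) (proj₁ (paint-injective {classOf u v} {i} {side u} {s}
                   (trans (sym (colour-in vu-in)) coloured))) (out-arc-class uv-out))

        module LoopFree {v : Fin n} {i : Fin k} (no-loop : π i v v ≡ false) where

          out-neighbour : ∃ λ w → π i v w ≡ true
          out-neighbour = meets-every-row π π-matchings v (rowSum-multiplicity v) i

          w : Fin n
          w = proj₁ out-neighbour

          vw-class : π i v w ≡ true
          vw-class = proj₂ out-neighbour

          v≢w : v ≢ w
          v≢w v≡w = true≢false (trans (sym vw-class) (subst (λ x → π i v x ≡ false) v≡w no-loop))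

          vw-out : O v w ≡ 1
          vw-out = class⇒arc v≢w vw-class

          coloured-out : colour v w ≡ paint i (side v)
          coloured-out = trans (colour-out vw-out) (cong (λ j → paint j (side v)) (classOf-unique v≢w vw-class))

          in-neighbour : ∃ λ u → π i u v ≡ true
          in-neighbour = meets-every-column π π-matchings v (colSum-multiplicity v) i

          u : Fin n
          u = proj₁ in-neighbour

          uv-class : π i u v ≡ true
          uv-class = proj₂ in-neighbour

          u≢v : u ≢ v
          u≢v u≡v = true≢false (trans (sym uv-class) (subst (λ x → π i x v ≡ false) (sym u≡v) no-loop))

          uv-out : O u v ≡ 1
          uv-out = class⇒arc u≢v uv-class

          uv-adjacent : adj G u v ≡ true
          uv-adjacent = arc⇒adj (subst (0 <_) (sym uv-out) (s≤s z≤n))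

          coloured-in : colour v u ≡ paint i (side u)
          coloured-in = trans (colour-in (arc⇒no-reverse (subst (0 <_) (sym uv-out) (s≤s z≤n))))
                          (cong (λ j → paint j (side u)) (classOf-unique u≢v uv-class))

          occurs-both-sides : ∀ s → occurs v (paint i s) ≡ true
          occurs-both-sides s with s ≟ᵇ side v
          ... | yes refl = occurs-complete (arc⇒adj (subst (0 <_) (sym vw-out) (s≤s z≤n))) coloured-out
          ... | no  s≢v  = occurs-complete (trans (Graph.sym G v u) uv-adjacent)
                             (trans coloured-in (cong (paint i) (trans (¬-not (bipartite u v uv-adjacent)) (sym (¬-not s≢v)))))

        occurs-paint : ∀ v i s → occurs v (paint i s) ≡ not (π i v v)
        occurs-paint v i s = bool-ext (λ occ → cong not (occurs⇒no-loop {v} {i} {s} occ))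
                                      (λ no-loop → LoopFree.occurs-both-sides (trans (sym (not-involutive (π i v v))) (cong not no-loop)) s)

        missing : Fin n → Vec Bool k
        missing v = Vec.tabulate (λ i → not (π i v v))

        size-missing : ∀ v → size (missing v) ≡ half v
        size-missing v = begin
          size (missing v)                      ≡⟨ size-tabulate (λ i → not (π i v v)) ⟩
          count (not ∘ loops)                   ≡⟨ m+n∸n≡m (count (not ∘ loops)) (count loops) ⟨
          count (not ∘ loops) + count loops ∸ count loops ≡⟨ cong₂ _∸_ (count-not loops) (trans (π-counts v v) (M-diagonal v)) ⟩
          k ∸ (k ∸ half v)                      ≡⟨ m∸[m∸n]≡n (half≤k v) ⟩
          half v                                ∎
          where
          open ≡-Reasoning
          loops : Fin k → Bool
          loops i = π i v v

        untag : Fin k ⊎ Fin k → Fin k × Bool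
        untag (inj₁ i) = i , false
        untag (inj₂ i) = i , true

        tagged-untag : ∀ x → tagged (proj₁ (untag x)) (proj₂ (untag x)) ≡ x
        tagged-untag (inj₁ i) = refl
        tagged-untag (inj₂ i) = refl

        classIndex : Fin (k + k) → Fin k
        classIndex κ = proj₁ (untag (splitAt k κ))

        tagOf : Fin (k + k) → Bool
        tagOf κ = proj₂ (untag (splitAt k κ))

        paint-classIndex : ∀ κ → paint (classIndex κ) (tagOf κ) ≡ κ
        paint-classIndex κ = trans (cong (join k k) (tagged-untag (splitAt k κ))) (join-splitAt k k κ)

        expand : Vec Bool k → Vec Bool (k + k)
        expand s = Vec.tabulate (λ κ → Vec.lookup s (classIndex κ))

        palette≡expand : ∀ v → palette G colour v ≡ expand (missing v)
        palette≡expand v = VecP.tabulate-cong λ κ → begin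
          occurs v κ                                           ≡⟨ cong (occurs v) (paint-classIndex κ) ⟨
          occurs v (paint (classIndex κ) (tagOf κ))            ≡⟨ occurs-paint v (classIndex κ) (tagOf κ) ⟩
          not (π (classIndex κ) v v)                           ≡⟨ VecP.lookup∘tabulate (λ i → not (π i v v)) (classIndex κ) ⟨
          Vec.lookup (missing v) (classIndex κ)                ∎
          where open ≡-Reasoning

        candidates : List (Vec Bool k)
        candidates = concatMap (λ d → subsetsOfSize k ⌊ d /2⌋) (degreeSet G)

        missing∈candidates : ∀ v → missing v ∈ candidates
        missing∈candidates v = ∈-concatMap⁺ (λ d → subsetsOfSize k ⌊ d /2⌋) (Any.map at-degree (∈-deduplicate⁺ ℕₚ._≟_ (∈-map⁺ (degree G) (∈-allFin v))))
          where
          at-degree : ∀ {d} → degree G v ≡ d → missing v ∈ subsetsOfSize k ⌊ d /2⌋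
          at-degree refl = subst (λ j → missing v ∈ subsetsOfSize k j) (size-missing v) (∈-subsetsOfSize (missing v))

        palette-count : numPalettes G colour ≤ binomialBound G
        palette-count = begin
          numPalettes G colour
            ≤⟨ unique-length-≤ _ (map expand candidates) (deduplicate-! (VecP.≡-dec _≟ᵇ_) palettes) palette∈ ⟩
          length (map expand candidates)                                  ≡⟨ length-map expand candidates ⟩
          length candidates                                               ≡⟨ length-concatMap _ (degreeSet G) ⟩
          listSum (map (λ d → length (subsetsOfSize k ⌊ d /2⌋)) (degreeSet G))
            ≡⟨ cong listSum (map-cong (λ d → length-subsetsOfSize k ⌊ d /2⌋) (degreeSet G)) ⟩
          binomialBound G                                                 ∎
          where
          open ≤-Reasoning
          palettes : List (Vec Bool (k + k))
          palettes = map (palette G colour) (allFin n)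
          palette∈ : ∀ {p} → p ∈ deduplicate (VecP.≡-dec _≟ᵇ_) palettes → p ∈ map expand candidates
          palette∈ p∈ with ∈-map⁻ (palette G colour) (∈-deduplicate⁻ (VecP.≡-dec _≟ᵇ_) palettes p∈)
          ... | v , _ , refl = subst (_∈ map expand candidates) (sym (palette≡expand v)) (∈-map⁺ expand (missing∈candidates v))


open import Data.Nat using (ℕ; _+_)
open import Data.Nat.Properties using (≤-reflexive)
open import Data.Product using (∃; _×_; _,_; proj₁; proj₂)
open import Relation.Binary.PropositionalEquality using (_≡_)
open import Defs
open EulerOrientation
open KonigColouring
open PaletteConstruction

theorem2p2 : (n : ℕ) (G : Graph n) → Bipartite G → NoIsolatedVertices G → AllDegreesEven G
           → PaletteIndex≤ G (binomialBound G)
theorem2p2 n G (side , bipartite) no-isolated even-degrees =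
  k + k , colour , (colour-symmetric , colour-proper) , palette-count
  where
  open Construction G side bipartite no-isolated even-degrees
  orientation : ∃ λ O → Orientation A O × Balanced O
  orientation = euler-orientation A A-even
  open Oriented (proj₁ orientation) (proj₁ (proj₂ orientation)) (proj₂ (proj₂ orientation))
  decomposition : ∃ λ π → Matchings π × (∀ r c → multiplicity π r c ≡ M r c)
  decomposition = konig M (λ r → ≤-reflexive (rowSum-M r)) (λ c → ≤-reflexive (colSum-M c))
  open Decomposed (proj₁ decomposition) (proj₁ (proj₂ decomposition)) (proj₂ (proj₂ decomposition))
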